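{- For all integers $n\ge 7$, the $n\times n$ knight graph satisfies $c(\mathcal{N}_n)\le 4$.
   Context: The $n\times n$ knight graph $\mathcal{N}_n$ has vertex set $\{1,\dots,n\}^2$, with $(a,b)$ and $(a',b')$ adjacent iff $(a'-a,b'-b)\in\{(\pm1,\pm2),(\pm2,\pm1)\}$. Cops and robbers: cops are placed on vertices, then the robber chooses a vertex; players alternate turns, cops first, each moving along an edge or staying put; cops win if some cop occupies the robber's vertex after finitely many turns. The cop number $c(G)$ is the least number of cops that can always win. -}

module Defs where

open import Data.Nat using (ℕ; _≤_; ∣_-_∣)
open import Data.Fin using (Fin; toℕ)
open import Data.Product using (_×_; _,_; ∃-syntax; Σ-syntax)
open import Data.Sum using (_⊎_)
open import Relation.Binary.PropositionalEquality using (_≡_)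

record Graph : Set₁ where
  field
    Vertex : Set
    Adj    : Vertex → Vertex → Set
open Graph public

-- Vertices are Fin n × Fin n (coordinates 0..n-1,
-- a relabelling of {1..n}²); (a,b) ~ (a',b') iff (|a'-a|,|b'-b|) ∈ {(1,2),(2,1)},
-- which is exactly (a'-a,b'-b) ∈ {(±1,±2),(±2,±1)}.
KnightAdj : (n : ℕ) → Fin n × Fin n → Fin n × Fin n → Set
KnightAdj n (a , b) (a' , b') =
  (∣ toℕ a' - toℕ a ∣ ≡ 1 × ∣ toℕ b' - toℕ b ∣ ≡ 2) ⊎
  (∣ toℕ a' - toℕ a ∣ ≡ 2 × ∣ toℕ b' - toℕ b ∣ ≡ 1)

Knight : ℕ → Graph
Knight n = record { Vertex = Fin n × Fin n ; Adj = KnightAdj n }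

module _ (G : Graph) where
  private
    V = Vertex G

  Step : V → V → Set
  Step x y = x ≡ y ⊎ Adj G x y

  Caught : {k : ℕ} → (Fin k → V) → V → Set
  Caught {k} C v = ∃[ i ] C i ≡ v

  -- CopsWinFrom k C r : it is the cops' turn, cops at C, robber at r (not caught);
  -- the cops can force capture within finitely many turns (inductive = well-founded).
  data CopsWinFrom (k : ℕ) (C : Fin k → V) (r : V) : Set where
    move : (C' : Fin k → V) → (∀ i → Step (C i) (C' i)) →
           (Caught C' r ⊎
             (∀ r' → Step r r' → Caught C' r' ⊎ CopsWinFrom k C' r')) →
           CopsWinFrom k C r

  -- k cops win: they choose initial positions, then the robber chooses a vertex,
  -- then play alternates starting with the cops.
  CopsWin : ℕ → Set
  CopsWin k = Σ[ C ∈ (Fin k → V) ] (∀ r → Caught C r ⊎ CopsWinFrom k C r)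

  CopNumber≤ : ℕ → Set
  CopNumber≤ m = ∃[ k ] (k ≤ m × CopsWin k)

{-# OPTIONS --safe #-}
-- The four cops occupy a 2×2 block {a, a+1} × {b, b+1} and always move together by a single
-- knight move.  Every coordinate in [a−2, a+3] is at distance 0, 1 or 2 from one of the block's
-- columns, and checking the combinations shows that from each square of [a−2, a+3] × [b−2, b+3]
-- except its four corners some cop steps onto the robber.  Starting from the corner (0, 0), the
-- block jumps by (2, 1) while the robber is at least four columns and four rows ahead; this keeps
-- him above and to the right of it.  Once his row lies in [b−2, b+3], the block instead moves one
-- or two columns towards him, choosing its new rows so that his row stays in the new band however
-- he moves (symmetrically with rows and columns exchanged).  Every round advances the block by at
-- least one column or row while he cannot slip past it, so he is caught.
module Submission where

open import Defs
open import Data.Nat using (ℕ; zero; suc; _+_; _≤_; _<_; ∣_-_∣; z≤n; s≤s; s≤s⁻¹)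
open import Data.Nat.Properties
open import Data.Fin as Fin using (Fin; toℕ; fromℕ<; combine; remQuot)
open import Data.Fin.Patterns using (0F; 1F)
open import Data.Fin.Properties using (toℕ<n; toℕ-fromℕ<; toℕ-injective; remQuot-combine)
open import Data.Product as Product using (_×_; _,_; proj₁; proj₂; ∃-syntax; Σ-syntax)
open import Data.Sum using (_⊎_; inj₁; inj₂)
open import Data.Empty using (⊥; ⊥-elim)
open import Data.Vec.Functional using (updateAt)
open import Data.Vec.Functional.Properties using (updateAt-updates; updateAt-minimal)
open import Function using (_∘_; const)
open import Relation.Nullary using (yes; no)
open import Relation.Binary.PropositionalEquality

capture : ∀ {G k C r} (i : Fin k) → Step G (C i) r → CopsWinFrom G k C r
capture {G} {C = C} {r} i step = move C′ steps (inj₁ (i , updateAt-updates i C))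
  where
    C′ = updateAt C i (const r)
    steps : ∀ j → Step G (C j) (C′ j)
    steps j with j Fin.≟ i
    ... | yes refl = subst (Step G (C j)) (sym (updateAt-updates j C)) step
    ... | no j≢i   = inj₁ (sym (updateAt-minimal j i C j≢i))

∣m-n+m∣≡n : ∀ m n → ∣ m - n + m ∣ ≡ n
∣m-n+m∣≡n m n = trans (cong (∣ m -_∣) (+-comm n m)) (∣m-m+n∣≡n m n)

∣n+m-m∣≡n : ∀ m n → ∣ n + m - m ∣ ≡ n
∣n+m-m∣≡n m n = trans (∣-∣-comm (n + m) m) (∣m-n+m∣≡n m n)

∣m-n∣≤o⇒n≤o+m : ∀ m n {o} → ∣ m - n ∣ ≤ o → n ≤ o + m
∣m-n∣≤o⇒n≤o+m m n {o} h =
  ≤-trans (m≤n+∣n-m∣ n m) (≤-trans (+-monoʳ-≤ m h) (≤-reflexive (+-comm m o)))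

spend-fuel : ∀ {m k a a′} → m ≤ suc k + a → a < a′ → m ≤ k + a′
spend-fuel {k = k} {a} {a′} fuel a<a′ =
  ≤-trans fuel (subst (_≤ k + a′) (+-suc k a) (+-monoʳ-≤ k a<a′))

out-of-fuel : ∀ {m a x} → m ≤ a → a ≤ x → x < m → ⊥
out-of-fuel m≤a a≤x x<m = <⇒≱ (≤-<-trans a≤x x<m) m≤a

KnightMove : ℕ → ℕ → ℕ → ℕ → Set
KnightMove a b a′ b′ =
  (∣ a′ - a ∣ ≡ 1 × ∣ b′ - b ∣ ≡ 2) ⊎ (∣ a′ - a ∣ ≡ 2 × ∣ b′ - b ∣ ≡ 1)

KnightMove-transpose : ∀ {a b a′ b′} → KnightMove a b a′ b′ → KnightMove b a b′ a′
KnightMove-transpose (inj₁ (da , db)) = inj₂ (db , da)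
KnightMove-transpose (inj₂ (da , db)) = inj₁ (db , da)

KnightMove-translate : ∀ {a b a′ b′} u v →
                       KnightMove a b a′ b′ → KnightMove (u + a) (v + b) (u + a′) (v + b′)
KnightMove-translate {a} {b} {a′} {b′} u v m
  rewrite ∣m+n-m+o∣≡∣n-o∣ u a′ a | ∣m+n-m+o∣≡∣n-o∣ v b′ b = m

Jump : ℕ → ℕ → Set
Jump b b′ = ∣ b′ - b ∣ ≡ 1 ⊎ ∣ b′ - b ∣ ≡ 2

sidestep : ∀ {b b′} a → Jump b b′ → ∃[ a′ ] (a < a′ × a′ ≤ 2 + a × KnightMove a b a′ b′)
sidestep a (inj₁ db) = 2 + a , n≤1+n (suc a) , ≤-refl , inj₂ (∣n+m-m∣≡n a 2 , db)
sidestep a (inj₂ db) = 1 + a , ≤-refl , n≤1+n (suc a) , inj₁ (∣n+m-m∣≡n a 1 , db)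

Close : ℕ → ℕ → Set
Close u v = u ≤ 2 + v × v ≤ 2 + u

∣m-n∣≤2⇒Close : ∀ {u v} → ∣ v - u ∣ ≤ 2 → Close u v
∣m-n∣≤2⇒Close {u} {v} h =
  ∣m-n∣≤o⇒n≤o+m v u h , ∣m-n∣≤o⇒n≤o+m u v (subst (_≤ 2) (∣-∣-comm v u) h)

Close-lower-bound : ∀ {m x x′} → Close x x′ → 2 + m ≤ x → m ≤ x′
Close-lower-bound {m} {x′ = x′} (x≤ , _) 2+m≤x = +-cancelˡ-≤ 2 m x′ (≤-trans 2+m≤x x≤)

Band : ℕ → ℕ → Set
Band a x = a ≤ 2 + x × x ≤ 3 + a

Core : ℕ → ℕ → Set
Core a x = a ≤ 1 + x × x ≤ 2 + a

data Offset : ℕ → ℕ → Set where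
  off-2 : ∀ x → Offset (2 + x) x
  off-1 : ∀ x → Offset (1 + x) x
  off0  : ∀ a → Offset a a
  off1  : ∀ a → Offset a (1 + a)
  off2  : ∀ a → Offset a (2 + a)
  off3  : ∀ a → Offset a (3 + a)

Offset-suc : ∀ {a x} → Offset a x → Offset (suc a) (suc x)
Offset-suc (off-2 x) = off-2 (suc x)
Offset-suc (off-1 x) = off-1 (suc x)
Offset-suc (off0 a)  = off0 (suc a)
Offset-suc (off1 a)  = off1 (suc a)
Offset-suc (off2 a)  = off2 (suc a)
Offset-suc (off3 a)  = off3 (suc a)

offset : ∀ a x → Band a x → Offset a x
offset zero    zero    _ = off0 0
offset zero    1       _ = off1 0
offset zero    2       _ = off2 0
offset zero    3       _ = off3 0
offset 1       zero    _ = off-1 0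
offset 2       zero    _ = off-2 0
offset zero    (suc (suc (suc (suc _)))) (_ , s≤s (s≤s (s≤s ())))
offset (suc (suc (suc _))) zero (s≤s (s≤s ()) , _)
offset (suc a) (suc x) (s≤s a≤ , s≤s x≤) = Offset-suc (offset a x (a≤ , x≤))

Reach : ℕ → ℕ → ℕ → Set
Reach d a x = Σ[ u ∈ Fin 2 ] ∣ x - (toℕ u + a) ∣ ≡ d

core-reach : ∀ {a x} → Core a x → Reach 1 a x × (Reach 0 a x ⊎ Reach 2 a x)
core-reach {a} {x} (a≤ , x≤) with offset a x (m≤n⇒m≤1+n a≤ , m≤n⇒m≤1+n x≤)
... | off-2 x = ⊥-elim (1+n≰n a≤)
... | off-1 x = (0F , ∣m-n+m∣≡n x 1) , inj₂ (1F , ∣m-n+m∣≡n x 2)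
... | off0 a  = (1F , ∣m-n+m∣≡n a 1) , inj₁ (0F , ∣m-n+m∣≡n a 0)
... | off1 a  = (0F , ∣n+m-m∣≡n a 1) , inj₁ (1F , ∣m-n+m∣≡n a 0)
... | off2 a  = (1F , ∣n+m-m∣≡n a 1) , inj₂ (0F , ∣n+m-m∣≡n a 2)
... | off3 a  = ⊥-elim (1+n≰n x≤)

band-reach : ∀ {a x} → Band a x → Reach 2 a x ⊎ (Reach 0 a x × Reach 1 a x)
band-reach {a} {x} band with offset a x band
... | off-2 x = inj₁ (0F , ∣m-n+m∣≡n x 2)
... | off-1 x = inj₁ (1F , ∣m-n+m∣≡n x 2)
... | off0 a  = inj₂ ((0F , ∣m-n+m∣≡n a 0) , (1F , ∣m-n+m∣≡n a 1))
... | off1 a  = inj₂ ((1F , ∣m-n+m∣≡n a 0) , (0F , ∣n+m-m∣≡n a 1))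
... | off2 a  = inj₁ (0F , ∣n+m-m∣≡n a 2)
... | off3 a  = inj₁ (1F , ∣n+m-m∣≡n a 2)

Catchable : ℕ → ℕ → ℕ → ℕ → Set
Catchable a b x y = Core a x × Band b y ⊎ Band a x × Core b y

data Position (a b x y : ℕ) : Set where
  near   : Catchable a b x y → Position a b x y
  right  : 3 + a ≤ x → Band b y → Position a b x y
  above  : 3 + b ≤ y → Band a x → Position a b x y
  beyond : 4 + a ≤ x → 4 + b ≤ y → Position a b x y

classify : ∀ {a b x y} → a ≤ x → b ≤ y → Position a b x y
classify {a} {b} {x} {y} a≤x b≤y with ≤-<-connex x (2 + a) | ≤-<-connex y (3 + b)
... | inj₁ x≤ | inj₁ y≤ = near (inj₁ ((m≤n⇒m≤1+n a≤x , x≤) , (≤-trans b≤y (m≤n+m y 2) , y≤)))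
... | inj₁ x≤ | inj₂ y> = above (≤-trans (n≤1+n _) y>) (≤-trans a≤x (m≤n+m x 2) , m≤n⇒m≤1+n x≤)
... | inj₂ x> | inj₁ y≤ = right x> (≤-trans b≤y (m≤n+m y 2) , y≤)
... | inj₂ x> | inj₂ y> with ≤-<-connex x (3 + a)
...   | inj₁ x≤ = above (≤-trans (n≤1+n _) y>) (≤-trans a≤x (m≤n+m x 2) , x≤)
...   | inj₂ x>′ = beyond x>′ y>

data StepDistances : ℕ → ℕ → Set where
  stay     : StepDistances 0 0
  knight₁₂ : StepDistances 1 2
  knight₂₁ : StepDistances 2 1

module Board (n : ℕ) where

  V : Set
  V = Fin n × Fin n

  X Y : V → ℕ
  X = toℕ ∘ proj₁
  Y = toℕ ∘ proj₂

  X<n : ∀ r → X r < n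
  X<n r = toℕ<n (proj₁ r)

  Y<n : ∀ r → Y r < n
  Y<n r = toℕ<n (proj₂ r)

  point : (x y : ℕ) → x < n → y < n → V
  point x y x<n y<n = fromℕ< x<n , fromℕ< y<n

  step-to : ∀ {x y d d′ r} (x<n : x < n) (y<n : y < n) → StepDistances d d′ →
            ∣ X r - x ∣ ≡ d → ∣ Y r - y ∣ ≡ d′ → Step (Knight n) (point x y x<n y<n) r
  step-to x<n y<n stay dx dy =
    inj₁ (cong₂ _,_ (toℕ-injective (trans (toℕ-fromℕ< x<n) (sym (∣m-n∣≡0⇒m≡n dx))))
                    (toℕ-injective (trans (toℕ-fromℕ< y<n) (sym (∣m-n∣≡0⇒m≡n dy)))))
  step-to x<n y<n knight₁₂ dx dy rewrite toℕ-fromℕ< x<n | toℕ-fromℕ< y<n = inj₂ (inj₁ (dx , dy))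
  step-to x<n y<n knight₂₁ dx dy rewrite toℕ-fromℕ< x<n | toℕ-fromℕ< y<n = inj₂ (inj₂ (dx , dy))

  point-adj : ∀ {x y x′ y′} (x<n : x < n) (y<n : y < n) (x′<n : x′ < n) (y′<n : y′ < n) →
              KnightMove x y x′ y′ → KnightAdj n (point x y x<n y<n) (point x′ y′ x′<n y′<n)
  point-adj x<n y<n x′<n y′<n m
    rewrite toℕ-fromℕ< x<n | toℕ-fromℕ< y<n | toℕ-fromℕ< x′<n | toℕ-fromℕ< y′<n = m

  step-distances : ∀ {r r′} → Step (Knight n) r r′ → ∣ X r′ - X r ∣ ≤ 2 × ∣ Y r′ - Y r ∣ ≤ 2
  step-distances {r} (inj₁ refl) =
    ≤-trans (≤-reflexive (∣n-n∣≡0 (X r))) z≤n , ≤-trans (≤-reflexive (∣n-n∣≡0 (Y r))) z≤n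
  step-distances (inj₂ (inj₁ (dx , dy))) = ≤-trans (≤-reflexive dx) (n≤1+n 1) , ≤-reflexive dy
  step-distances (inj₂ (inj₂ (dx , dy))) = ≤-reflexive dx , ≤-trans (≤-reflexive dy) (n≤1+n 1)

  step-bounds : ∀ {r r′} → Step (Knight n) r r′ → Close (X r) (X r′) × Close (Y r) (Y r′)
  step-bounds s = Product.map ∣m-n∣≤2⇒Close ∣m-n∣≤2⇒Close (step-distances s)

  shifted<n : ∀ {a} (u : Fin 2) → 2 + a ≤ n → toℕ u + a < n
  shifted<n {a} u ha = <-≤-trans (+-monoˡ-< a (toℕ<n u)) ha

  cop : ∀ {a b} → 2 + a ≤ n → 2 + b ≤ n → Fin 2 × Fin 2 → V
  cop {a} {b} ha hb (u , v) = point (toℕ u + a) (toℕ v + b) (shifted<n u ha) (shifted<n v hb)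

  block : ∀ a b → 2 + a ≤ n → 2 + b ≤ n → Fin 4 → V
  block a b ha hb = cop ha hb ∘ remQuot {2} 2

  BlockWins : ℕ → ℕ → V → Set
  BlockWins a b r = (ha : 2 + a ≤ n) (hb : 2 + b ≤ n) → CopsWinFrom (Knight n) 4 (block a b ha hb) r

  block-catch : ∀ {a b d d′ r} →
                Reach d a (X r) → Reach d′ b (Y r) → StepDistances d d′ → BlockWins a b r
  block-catch {r = r} (u , dx) (v , dy) s ha hb =
    capture (combine u v)
      (subst (λ c → Step (Knight n) c r) (cong (cop ha hb) (sym (remQuot-combine u v)))
             (step-to (shifted<n u ha) (shifted<n v hb) s dx dy))

  catch-near : ∀ {a b r} → Catchable a b (X r) (Y r) → BlockWins a b r
  catch-near (inj₁ (core , band)) with core-reach core | band-reach band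
  ... | x₁ , _        | inj₁ y₂       = block-catch x₁ y₂ knight₁₂
  ... | _ , inj₁ x₀   | inj₂ (y₀ , _) = block-catch x₀ y₀ stay
  ... | _ , inj₂ x₂   | inj₂ (_ , y₁) = block-catch x₂ y₁ knight₂₁
  catch-near (inj₂ (band , core)) with band-reach band | core-reach core
  ... | inj₁ x₂       | y₁ , _        = block-catch x₂ y₁ knight₂₁
  ... | inj₂ (x₀ , _) | _ , inj₁ y₀   = block-catch x₀ y₀ stay
  ... | inj₂ (_ , x₁) | _ , inj₂ y₂   = block-catch x₁ y₂ knight₁₂

  block-move : ∀ {a b a′ b′ r} → KnightMove a b a′ b′ → (ha′ : 2 + a′ ≤ n) (hb′ : 2 + b′ ≤ n) →
               (∀ r′ → Step (Knight n) r r′ → CopsWinFrom (Knight n) 4 (block a′ b′ ha′ hb′) r′) →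
               BlockWins a b r
  block-move {a} {b} {a′} {b′} m ha′ hb′ reply ha hb =
    move (block a′ b′ ha′ hb′) step (inj₂ λ r′ s → inj₂ (reply r′ s))
    where
      step : ∀ i → Step (Knight n) (block a b ha hb i) (block a′ b′ ha′ hb′ i)
      step i = inj₂ (point-adj (shifted<n u ha) (shifted<n v hb) (shifted<n u ha′) (shifted<n v hb′)
                                (KnightMove-translate (toℕ u) (toℕ v) m))
        where
          u = proj₁ (remQuot {2} 2 i)
          v = proj₂ (remQuot {2} 2 i)

module Strategy {n : ℕ} (3≤n : 3 ≤ n) where
  open Board n

  Window : ℕ → ℕ → Set
  Window b′ y = ∀ y′ → y′ < n → Close y y′ → Band b′ y′

  window-within : ∀ {b′ y} → b′ ≤ y → y ≤ 1 + b′ → Window b′ y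
  window-within b′≤y y≤ _ _ (y≤′ , y′≤) = ≤-trans b′≤y y≤′ , ≤-trans y′≤ (+-monoʳ-≤ 2 y≤)

  track-top-edge : ∀ b → 2 + b ≤ n → n ≤ 2 + b → ∃[ b′ ] (2 + b′ ≤ n × Jump b b′ × Window b′ (1 + b))
  track-top-edge zero    _  n≤2   = ⊥-elim (<⇒≱ 3≤n n≤2)
  track-top-edge (suc c) hb n≤3+c = c , ≤-trans (n≤1+n _) hb , inj₁ (∣m-n+m∣≡n c 1) , window
    where
      window : Window c (2 + c)
      window y′ y′<n (y≤ , _) =
        ≤-trans (+-cancelˡ-≤ 2 c y′ y≤) (m≤n+m y′ 2) , ≤-trans (s≤s⁻¹ (≤-trans y′<n n≤3+c)) (n≤1+n _)

  -- b′ is y or y − 1, except at the edges of the board.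
  track : ∀ {b y} → Band b y → y < n → 2 + b ≤ n → ∃[ b′ ] (2 + b′ ≤ n × Jump b b′ × Window b′ y)
  track {b} {y} band y<n hb with offset b y band
  ... | off-2 y = y , ≤-trans (m≤n+m (2 + y) 2) hb , inj₂ (∣m-n+m∣≡n y 2) , window-within ≤-refl (n≤1+n y)
  ... | off-1 y = y , ≤-trans (m≤n+m (2 + y) 1) hb , inj₁ (∣m-n+m∣≡n y 1) , window-within ≤-refl (n≤1+n y)
  ... | off0 zero = 1 , 3≤n , inj₁ refl , λ _ _ (_ , y′≤2) → s≤s z≤n , ≤-trans y′≤2 (m≤n+m 2 2)
  ... | off0 (suc c) = c , ≤-trans (n≤1+n _) hb , inj₁ (∣m-n+m∣≡n c 1) , window-within (n≤1+n c) ≤-refl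
  ... | off2 b = 1 + b , y<n , inj₁ (∣n+m-m∣≡n b 1) , window-within (n≤1+n _) ≤-refl
  ... | off3 b = 2 + b , y<n , inj₂ (∣n+m-m∣≡n b 2) , window-within (n≤1+n _) ≤-refl
  ... | off1 b with ≤-<-connex (3 + b) n
  ...   | inj₁ hb′   = 1 + b , hb′ , inj₁ (∣n+m-m∣≡n b 1) , window-within ≤-refl (n≤1+n _)
  ...   | inj₂ n<3+b = track-top-edge b hb (s≤s⁻¹ n<3+b)

  chase-right : ∀ k {a b r} → n ≤ k + a → 3 + a ≤ X r → Band b (Y r) → BlockWins a b r
  chase-right zero {a} {r = r} fuel ax _ _ _ =
    ⊥-elim (out-of-fuel fuel (≤-trans (m≤n+m a 3) ax) (X<n r))
  chase-right (suc k) {a} {b} {r} fuel ax band ha hb with track band (Y<n r) hb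
  ... | b′ , hb′ , jump , window with sidestep {b} {b′} a jump
  ... | a′ , a<a′ , a′≤2+a , m = block-move m ha′ hb′ reply ha hb
    where
      ha′ : 2 + a′ ≤ n
      ha′ = ≤-trans (+-monoʳ-≤ 2 a′≤2+a) (≤-trans (s≤s ax) (X<n r))
      reply : ∀ r′ → Step (Knight n) r r′ → CopsWinFrom (Knight n) 4 (block a′ b′ ha′ hb′) r′
      reply r′ s with step-bounds s | ≤-<-connex (X r′) (2 + a′)
      ... | xc , yc | inj₁ x′≤ =
        catch-near (inj₁ ((≤-trans a′≤2+a (s≤s (Close-lower-bound xc ax)) , x′≤) ,
                          window (Y r′) (Y<n r′) yc)) ha′ hb′
      ... | _  , yc | inj₂ ahead =
        chase-right k (spend-fuel fuel a<a′) ahead (window (Y r′) (Y<n r′) yc) ha′ hb′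

  chase-up : ∀ k {a b r} → n ≤ k + b → 3 + b ≤ Y r → Band a (X r) → BlockWins a b r
  chase-up zero {b = b} {r} fuel by _ _ _ =
    ⊥-elim (out-of-fuel fuel (≤-trans (m≤n+m b 3) by) (Y<n r))
  chase-up (suc k) {a} {b} {r} fuel by band ha hb with track band (X<n r) ha
  ... | a′ , ha′ , jump , window with sidestep {a} {a′} b jump
  ... | b′ , b<b′ , b′≤2+b , m =
    block-move (KnightMove-transpose {b} {a} {b′} {a′} m) ha′ hb′ reply ha hb
    where
      hb′ : 2 + b′ ≤ n
      hb′ = ≤-trans (+-monoʳ-≤ 2 b′≤2+b) (≤-trans (s≤s by) (Y<n r))
      reply : ∀ r′ → Step (Knight n) r r′ → CopsWinFrom (Knight n) 4 (block a′ b′ ha′ hb′) r′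
      reply r′ s with step-bounds s | ≤-<-connex (Y r′) (2 + b′)
      ... | xc , yc | inj₁ y′≤ =
        catch-near (inj₂ (window (X r′) (X<n r′) xc ,
                          (≤-trans b′≤2+b (s≤s (Close-lower-bound yc by)) , y′≤))) ha′ hb′
      ... | xc , _  | inj₂ ahead =
        chase-up k (spend-fuel fuel b<b′) ahead (window (X r′) (X<n r′) xc) ha′ hb′

  pursue : ∀ k {a b r} → n ≤ k + a → a ≤ X r → b ≤ Y r → BlockWins a b r
  pursue-diagonally : ∀ k {a b r} → n ≤ k + a → 4 + a ≤ X r → 4 + b ≤ Y r → BlockWins a b r

  pursue k {a} {b} fuel ax by with classify ax by
  ... | near c        = catch-near c
  ... | right x> band = chase-right n (m≤m+n n a) x> band
  ... | above y> band = chase-up n (m≤m+n n b) y> band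
  ... | beyond x> y>  = pursue-diagonally k fuel x> y>

  pursue-diagonally zero {a} {r = r} fuel x> _ =
    ⊥-elim (out-of-fuel fuel (≤-trans (m≤n+m a 4) x>) (X<n r))
  pursue-diagonally (suc k) {a} {b} {r} fuel x> y> =
    block-move (inj₂ (∣n+m-m∣≡n a 2 , ∣n+m-m∣≡n b 1)) ha′ hb′ reply
    where
      ha′ : 2 + (2 + a) ≤ n
      ha′ = ≤-trans x> (<⇒≤ (X<n r))
      hb′ : 2 + (1 + b) ≤ n
      hb′ = ≤-trans (n≤1+n _) (≤-trans y> (<⇒≤ (Y<n r)))
      reply : ∀ r′ → Step (Knight n) r r′ → CopsWinFrom (Knight n) 4 (block (2 + a) (1 + b) ha′ hb′) r′
      reply r′ s with step-bounds s
      ... | xc , yc = pursue k (spend-fuel fuel (n≤1+n (suc a)))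
                        (Close-lower-bound xc x>) (≤-trans (n≤1+n _) (Close-lower-bound yc y>)) ha′ hb′

  block-wins : CopsWin (Knight n) 4
  block-wins = block 0 0 2≤n 2≤n , λ r → inj₂ (pursue n (m≤m+n n 0) z≤n z≤n 2≤n 2≤n)
    where
      2≤n : 2 ≤ n
      2≤n = ≤-trans (n≤1+n 2) 3≤n

lemma2p2 : (n : ℕ) → 7 ≤ n → CopNumber≤ (Knight n) 4
lemma2p2 n 7≤n = 4 , ≤-refl , Strategy.block-wins (≤-trans (m≤m+n 3 4) 7≤n)
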